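{- There exist infinitely many positive integers $k$ such that $$\lim_{N \to \infty}\frac{\#\{0 \le n \le N : p(n,k) \text{ is odd}\}}{N} \le \frac{2}{3}.$$
   Context: For a nonnegative integer $n$ and a positive integer $k$, $p(n,k)$ denotes the number of partitions of $n$ into parts each less than or equal to $k$ (so $p(0,k)=1$); equivalently, $\sum_{n\ge 0} p(n,k)q^n = \prod_{i=1}^{k} \frac{1}{1-q^i}$. -}

module Defs where

open import Data.Nat using (ℕ; zero; suc; _+_; _*_; _∸_; _≤ᵇ_; _%_; _≥_)
open import Data.Bool using (if_then_else_)
open import Data.Integer using (+_)
open import Data.Rational using (ℚ; _/_; _-_; ∣_∣; _<_; _≤_; 0ℚ)
open import Data.Product using (∃-syntax)

sumTo : ℕ → (ℕ → ℕ) → ℕ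
sumTo zero    f = f 0
sumTo (suc n) f = sumTo n f + f (suc n)

-- p n k : number of partitions of n into parts each ≤ k (p 0 k = 1).
-- Recursion on k, splitting by the multiplicity j of the part k+1:
-- p(n, k+1) = Σ_{j : j(k+1) ≤ n} p(n - j(k+1), k).
p : ℕ → ℕ → ℕ
p n zero    = if n ≤ᵇ 0 then 1 else 0
p n (suc k) = sumTo n (λ j → if j * suc k ≤ᵇ n then p (n ∸ j * suc k) k else 0)

oddCount : ℕ → ℕ → ℕ
oddCount k N = sumTo N (λ n → p n k % 2)

oddRatio : ℕ → ℕ → ℚ
oddRatio k M = (+ oddCount k (suc M)) / suc M

ConvergesTo : (ℕ → ℚ) → ℚ → Set
ConvergesTo r L = ∀ (ε : ℚ) → 0ℚ < ε → ∃[ M₀ ] ∀ M → M ≥ M₀ → ∣ r M - L ∣ < ε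

-- Write A k n for the parity of p(n,k).  The recurrence p(n+k+1, k+1) = p(n+k+1, k) + p(n, k+1)
-- says that A (k+1) accumulates A k along steps of k+1:
--   A (k+1) (s+n) = A k (s+n) + A (k+1) n   (mod 2, s = k+1).
-- Two consequences of such an accumulation g(s+n) = h(s+n) + g(n) drive the proof:
--   * periodicity propagates: if h has a period T divisible by s, then g has period 2T
--     (accumulation-periodic); starting from the constant A 1, every A k (k ≥ 1) is periodic;
--   * on a common period T, h(s+m), g(s+m), g(m) are never all odd, so
--     count_T(h) + 2 count_T(g) ≤ 2T (accumulation-count); hence A k or A (k+1) is odd on at
--     most two thirds of a period.
-- Finally a periodic parity sequence has density count_T/T: the cross-multiplied error stays
-- bounded (count-periodic-error), which forces convergence of the ratios (ratio-converges).
module Submission where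

open import Defs
open import Data.Nat as ℕ
  using (ℕ; zero; suc; _+_; _*_; _∸_; _%_; _/_; _⊔_; _≤ᵇ_; _≤_; _≥_; _<_; _>_; z≤n; s≤s; ∣_-_∣)
open import Data.Nat.Properties
open import Algebra.Properties.CommutativeSemigroup +-commutativeSemigroup using (x∙yz≈y∙xz)
open import Data.Nat.Divisibility using (_∣_; divides; m∣m*n; n∣m*n)
open import Data.Nat.DivMod using (m≡m%n+[m/n]*n; m%n<n)
open import Data.Nat.Tactic.RingSolver using (solve-∀)
open import Data.Integer as ℤ using (ℤ; +[1+_]; -[1+_]; _⊖_)
import Data.Integer.Properties as ℤP
open import Data.Rational as ℚ using (ℚ; mkℚ; toℚᵘ)
import Data.Rational.Properties as ℚP
open import Data.Rational.Unnormalised as ℚᵘ using (mkℚᵘ; *<*; *≤*)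
import Data.Rational.Unnormalised.Properties as ℚᵘP
open import Data.Parity as ℙ using (Parity; 0ℙ; 1ℙ)
import Data.Parity.Properties as ℙP
open import Data.Bool using (true; false; if_then_else_; T)
open import Data.Product using (∃-syntax; _×_; _,_)
open import Data.Sum using (_⊎_; inj₁; inj₂)
open import Relation.Binary.PropositionalEquality
open import Function using (_∘_)
open import Relation.Nullary using (contradiction; yes; no)

sumTo-cong : ∀ n {f g : ℕ → ℕ} → (∀ j → f j ≡ g j) → sumTo n f ≡ sumTo n g
sumTo-cong zero    f≗g = f≗g 0
sumTo-cong (suc n) f≗g = cong₂ _+_ (sumTo-cong n f≗g) (f≗g (suc n))

sumTo-unfoldˡ : ∀ n (f : ℕ → ℕ) → sumTo (suc n) f ≡ f 0 + sumTo n (f ∘ suc)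
sumTo-unfoldˡ zero    f = refl
sumTo-unfoldˡ (suc n) f =
  trans (cong (_+ f (suc (suc n))) (sumTo-unfoldˡ n f)) (+-assoc (f 0) _ _)

sumTo-vanishing : ∀ m n (f : ℕ → ℕ) → (∀ j → n < j → f j ≡ 0) → sumTo (m + n) f ≡ sumTo n f
sumTo-vanishing zero    n f f>n≡0 = refl
sumTo-vanishing (suc m) n f f>n≡0 = begin
  sumTo (m + n) f + f (suc (m + n)) ≡⟨ cong (sumTo (m + n) f +_) (f>n≡0 _ (s≤s (m≤n+m n m))) ⟩
  sumTo (m + n) f + 0               ≡⟨ +-identityʳ _ ⟩
  sumTo (m + n) f                   ≡⟨ sumTo-vanishing m n f f>n≡0 ⟩
  sumTo n f                         ∎
  where open ≡-Reasoning

≤ᵇ-suc : ∀ m n → (suc m ≤ᵇ suc n) ≡ (m ≤ᵇ n)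
≤ᵇ-suc zero    n = refl
≤ᵇ-suc (suc m) n = refl

≤ᵇ-cancelˡ : ∀ a x y → (a + x ≤ᵇ a + y) ≡ (x ≤ᵇ y)
≤ᵇ-cancelˡ zero    x y = refl
≤ᵇ-cancelˡ (suc a) x y = trans (≤ᵇ-suc (a + x) (a + y)) (≤ᵇ-cancelˡ a x y)

withMultiplicity : ℕ → ℕ → ℕ → ℕ
withMultiplicity k n j = if j * suc k ≤ᵇ n then p (n ∸ j * suc k) k else 0

-- Removing one copy of the part k+1.
withMultiplicity-suc : ∀ k n j → withMultiplicity k (suc k + n) (suc j) ≡ withMultiplicity k n j
withMultiplicity-suc k n j =
  cong₂ (λ b m → if b then p m k else 0)
        (≤ᵇ-cancelˡ (suc k) (j * suc k) n)
        ([m+n]∸[m+o]≡n∸o (suc k) n (j * suc k))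

-- More than n copies of a positive part do not fit into n.
withMultiplicity-vanishing : ∀ k n j → n < j → withMultiplicity k n j ≡ 0
withMultiplicity-vanishing k n j n<j with j * suc k ≤ᵇ n in fits
... | false = refl
... | true  = contradiction (≤ᵇ⇒≤ _ n (subst T (sym fits) _)) (<⇒≱ (<-≤-trans n<j (m≤m*n j (suc k))))

p-recurrence : ∀ k n → p (suc k + n) (suc k) ≡ p (suc k + n) k + p n (suc k)
p-recurrence k n = begin
  p (suc k + n) (suc k)
    ≡⟨ sumTo-unfoldˡ (k + n) _ ⟩
  p (suc k + n) k + sumTo (k + n) (withMultiplicity k (suc k + n) ∘ suc)
    ≡⟨ cong (p (suc k + n) k +_) dropOneCopy ⟩
  p (suc k + n) k + p n (suc k) ∎
  where
  open ≡-Reasoning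
  dropOneCopy : sumTo (k + n) (withMultiplicity k (suc k + n) ∘ suc) ≡ p n (suc k)
  dropOneCopy = trans (sumTo-cong (k + n) (withMultiplicity-suc k n))
                      (sumTo-vanishing k n _ (withMultiplicity-vanishing k n))

A : ℕ → ℕ → Parity
A k n = ℕ.parity (p n k)

A-recurrence : ∀ k n → A (suc k) (suc k + n) ≡ A k (suc k + n) ℙ.+ A (suc k) n
A-recurrence k n = trans (cong ℕ.parity (p-recurrence k n)) (ℙP.+-homo-+ (p (suc k + n) k) (p n (suc k)))

record Periodic {X : Set} (f : ℕ → X) (T : ℕ) : Set where
  constructor periodic
  field shift : ∀ n → f (T + n) ≡ f n
open Periodic

periodic-* : ∀ {X : Set} {f : ℕ → X} {T} → Periodic f T → ∀ c → Periodic f (c * T)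
periodic-*             per zero    = periodic λ n → refl
periodic-* {f = f} {T} per (suc c) = periodic λ n →
  trans (cong f (+-assoc T (c * T) n)) (trans (shift per (c * T + n)) (shift (periodic-* per c) n))

periodic-∣ : ∀ {X : Set} {f : ℕ → X} {T U} → Periodic f T → T ∣ U → Periodic f U
periodic-∣ per (divides c refl) = periodic-* per c

+-cancel-common : ∀ x a b → (x ℙ.+ a) ℙ.+ (x ℙ.+ b) ≡ a ℙ.+ b
+-cancel-common 0ℙ a  b  = refl
+-cancel-common 1ℙ 0ℙ 0ℙ = refl
+-cancel-common 1ℙ 0ℙ 1ℙ = refl
+-cancel-common 1ℙ 1ℙ 0ℙ = refl
+-cancel-common 1ℙ 1ℙ 1ℙ = refl

-- If g(n+s) = h(n+s) + g(n) (g accumulates h along steps of s) and h has a period T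
-- that is a multiple of s, then g has period 2T: the defect D(n) = g(n+T) + g(n) is
-- s-periodic, hence T-periodic, so g(n+2T) + g(n) = D(n+T) + D(n) = 0.
accumulation-periodic : ∀ (g h : ℕ → Parity) s T → (∀ n → g (s + n) ≡ h (s + n) ℙ.+ g n) →
                        s ∣ T → Periodic h T → Periodic g (T + T)
accumulation-periodic g h s T step s∣T per-h = periodic λ n →
  trans (cong g (+-assoc T T n))
        (ℙP.+-cancelʳ-≡ (g (T + n)) _ _ (trans (shift (periodic-∣ defect-periodic s∣T) n) (ℙP.+-comm (g (T + n)) (g n))))
  where
  open ≡-Reasoning
  D : ℕ → Parity
  D n = g (T + n) ℙ.+ g n
  defect-periodic : Periodic D s
  defect-periodic = periodic λ n → begin
    g (T + (s + n)) ℙ.+ g (s + n)                     ≡⟨ cong₂ ℙ._+_ (cong g (x∙yz≈y∙xz T s n)) refl ⟩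
    g (s + (T + n)) ℙ.+ g (s + n)                     ≡⟨ cong₂ ℙ._+_ (step (T + n)) (step n) ⟩
    (h (s + (T + n)) ℙ.+ g (T + n)) ℙ.+ (h (s + n) ℙ.+ g n)
                                                      ≡⟨ cong (λ x → (x ℙ.+ g (T + n)) ℙ.+ (h (s + n) ℙ.+ g n))
                                                              (trans (cong h (sym (x∙yz≈y∙xz T s n))) (shift per-h (s + n))) ⟩
    (h (s + n) ℙ.+ g (T + n)) ℙ.+ (h (s + n) ℙ.+ g n) ≡⟨ +-cancel-common (h (s + n)) (g (T + n)) (g n) ⟩
    g (T + n) ℙ.+ g n                                 ∎

-- For every k ≥ 1 the parity sequence of p(·, k) is periodic: A 1 has period 1 (its recurrence
-- adds A 0 (n+1) = 0), and a period T of A k yields the period 2(k+1)T of A (k+1).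
A-periodic : ∀ k → ∃[ T ] Periodic (A (suc k)) (suc T)
A-periodic zero    = 0 , periodic (A-recurrence 0)
A-periodic (suc k) with A-periodic k
... | T , per = ℕ.pred (U + U) , accumulation-periodic (A (suc (suc k))) (A (suc k)) (suc (suc k)) U
                                   (A-recurrence (suc k)) (m∣m*n (suc T)) (periodic-∣ per (n∣m*n (suc (suc k))))
  where
  U : ℕ
  U = suc (suc k) * suc T

A-common-period : ∀ k → ∃[ T ] (Periodic (A (suc k)) (suc T) × Periodic (A (suc (suc k))) (suc T))
A-common-period k with A-periodic k | A-periodic (suc k)
... | T₁ , per₁ | T₂ , per₂ = ℕ.pred (suc T₁ * suc T₂) , periodic-∣ per₁ (m∣m*n (suc T₂)) , periodic-∣ per₂ (n∣m*n (suc T₁))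

⟦_⟧ : Parity → ℕ
⟦ 0ℙ ⟧ = 0
⟦ 1ℙ ⟧ = 1

⟦parity⟧≡%2 : ∀ n → ⟦ ℕ.parity n ⟧ ≡ n % 2
⟦parity⟧≡%2 zero          = refl
⟦parity⟧≡%2 (suc zero)    = refl
⟦parity⟧≡%2 (suc (suc n)) = ⟦parity⟧≡%2 n

count : ℕ → (ℕ → Parity) → ℕ
count zero    f = 0
count (suc n) f = count n f + ⟦ f n ⟧

oddCount≡count : ∀ k N → oddCount k N ≡ count (suc N) (A k)
oddCount≡count k zero    = sym (⟦parity⟧≡%2 (p 0 k))
oddCount≡count k (suc N) = cong₂ _+_ (oddCount≡count k N) (sym (⟦parity⟧≡%2 (p (suc N) k)))

count-cong : ∀ n {f g : ℕ → Parity} → (∀ m → f m ≡ g m) → count n f ≡ count n g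
count-cong zero    f≗g = refl
count-cong (suc n) f≗g = cong₂ _+_ (count-cong n f≗g) (cong ⟦_⟧ (f≗g n))

count-≤ : ∀ n f → count n f ≤ n
count-≤ zero    f = z≤n
count-≤ (suc n) f = ≤-trans (+-mono-≤ (count-≤ n f) (⟦⟧≤1 (f n))) (≤-reflexive (+-comm n 1))
  where
  ⟦⟧≤1 : ∀ x → ⟦ x ⟧ ≤ 1
  ⟦⟧≤1 0ℙ = z≤n
  ⟦⟧≤1 1ℙ = s≤s z≤n

count-+ : ∀ a b f → count (a + b) f ≡ count a f + count b (λ m → f (a + m))
count-+ a zero    f = trans (cong (λ n → count n f) (+-identityʳ a)) (sym (+-identityʳ (count a f)))
count-+ a (suc b) f = begin
  count (a + suc b) f                                         ≡⟨ cong (λ n → count n f) (+-suc a b) ⟩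
  count (a + b) f + ⟦ f (a + b) ⟧                              ≡⟨ cong (_+ ⟦ f (a + b) ⟧) (count-+ a b f) ⟩
  count a f + count b (λ m → f (a + m)) + ⟦ f (a + b) ⟧        ≡⟨ +-assoc (count a f) _ _ ⟩
  count a f + (count b (λ m → f (a + m)) + ⟦ f (a + b) ⟧)      ∎
  where open ≡-Reasoning

count-window : ∀ {f T} → Periodic f T → ∀ a → count T (λ m → f (a + m)) ≡ count T f
count-window {f} {T} per a = +-cancelˡ-≡ (count a f) _ _ (begin
  count a f + count T (λ m → f (a + m)) ≡⟨ count-+ a T f ⟨
  count (a + T) f                       ≡⟨ cong (λ n → count n f) (+-comm a T) ⟩
  count (T + a) f                       ≡⟨ count-+ T a f ⟩
  count T f + count a (λ m → f (T + m)) ≡⟨ cong (count T f +_) (count-cong a (shift per)) ⟩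
  count T f + count a f                 ≡⟨ +-comm (count T f) (count a f) ⟩
  count a f + count T f                 ∎)
  where open ≡-Reasoning

count-periodic : ∀ {f T} → Periodic f T → ∀ q r → count (q * T + r) f ≡ q * count T f + count r f
count-periodic         per zero    r = refl
count-periodic {f} {T} per (suc q) r = begin
  count (T + q * T + r) f                          ≡⟨ cong (λ n → count n f) (+-assoc T (q * T) r) ⟩
  count (T + (q * T + r)) f                        ≡⟨ count-+ T (q * T + r) f ⟩
  count T f + count (q * T + r) (λ m → f (T + m))  ≡⟨ cong (count T f +_) (count-cong (q * T + r) (shift per)) ⟩
  count T f + count (q * T + r) f                  ≡⟨ cong (count T f +_) (count-periodic per q r) ⟩
  count T f + (q * count T f + count r f)          ≡⟨ +-assoc (count T f) (q * count T f) (count r f) ⟨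
  suc q * count T f + count r f                    ∎
  where open ≡-Reasoning

-- A periodic sequence has asymptotic density count(Q)/Q with bounded error:
-- writing N = r + qQ, the error N·count(Q) − Q·count(N) equals r·count(Q) − Q·count(r).
count-periodic-error : ∀ {f T} → Periodic f (suc T) → ∀ N →
                       ∣ count N f * suc T - count (suc T) f * N ∣ ≤ suc T * suc T
count-periodic-error {f} {T} per N = begin
  ∣ count N f * Q - c * N ∣                         ≡⟨ cong₂ ∣_-_∣ countN*Q c*N ⟩
  ∣ q * c * Q + count r f * Q - q * c * Q + c * r ∣ ≡⟨ ∣m+n-m+o∣≡∣n-o∣ (q * c * Q) _ _ ⟩
  ∣ count r f * Q - c * r ∣                         ≤⟨ ∣m-n∣≤m⊔n (count r f * Q) (c * r) ⟩
  count r f * Q ⊔ c * r                             ≤⟨ ⊔-lub (*-monoˡ-≤ Q (≤-trans (count-≤ r f) r≤Q))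
                                                              (*-mono-≤ (count-≤ Q f) r≤Q) ⟩
  Q * Q                                             ∎
  where
  open ≤-Reasoning
  Q = suc T
  c = count Q f
  q = N / Q
  r = N % Q
  r≤Q : r ≤ Q
  r≤Q = <⇒≤ (m%n<n N Q)
  N≡r+qQ : N ≡ r + q * Q
  N≡r+qQ = m≡m%n+[m/n]*n N Q
  countN*Q : count N f * Q ≡ q * c * Q + count r f * Q
  countN*Q = begin-equality
    count N f * Q                  ≡⟨ cong (λ n → count n f * Q) (trans N≡r+qQ (+-comm r (q * Q))) ⟩
    count (q * Q + r) f * Q        ≡⟨ cong (_* Q) (count-periodic per q r) ⟩
    (q * c + count r f) * Q        ≡⟨ *-distribʳ-+ Q (q * c) (count r f) ⟩
    q * c * Q + count r f * Q      ∎
  c*N : c * N ≡ q * c * Q + c * r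
  c*N = trans (cong (c *_) N≡r+qQ) (rearrange q c r Q)
    where
    rearrange : ∀ q c r Q → c * (r + q * Q) ≡ q * c * Q + c * r
    rearrange = solve-∀

count-three-≤ : ∀ n (f₁ f₂ f₃ : ℕ → Parity) → (∀ m → ⟦ f₁ m ⟧ + ⟦ f₂ m ⟧ + ⟦ f₃ m ⟧ ≤ 2) →
                count n f₁ + count n f₂ + count n f₃ ≤ 2 * n
count-three-≤ zero    f₁ f₂ f₃ bound = z≤n
count-three-≤ (suc n) f₁ f₂ f₃ bound = begin
  (c₁ + x₁) + (c₂ + x₂) + (c₃ + x₃) ≡⟨ regroup c₁ c₂ c₃ x₁ x₂ x₃ ⟩
  (c₁ + c₂ + c₃) + (x₁ + x₂ + x₃)   ≤⟨ +-mono-≤ (count-three-≤ n f₁ f₂ f₃ bound) (bound n) ⟩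
  2 * n + 2                         ≡⟨ +-comm (2 * n) 2 ⟩
  2 + 2 * n                         ≡⟨ *-suc 2 n ⟨
  2 * suc n                         ∎
  where
  open ≤-Reasoning
  c₁ = count n f₁; c₂ = count n f₂; c₃ = count n f₃
  x₁ = ⟦ f₁ n ⟧;   x₂ = ⟦ f₂ n ⟧;   x₃ = ⟦ f₃ n ⟧
  regroup : ∀ c₁ c₂ c₃ x₁ x₂ x₃ → (c₁ + x₁) + (c₂ + x₂) + (c₃ + x₃) ≡ (c₁ + c₂ + c₃) + (x₁ + x₂ + x₃)
  regroup = solve-∀

⟦sum⟧+⟦summands⟧≤2 : ∀ y z → ⟦ y ℙ.+ z ⟧ + ⟦ y ⟧ + ⟦ z ⟧ ≤ 2
⟦sum⟧+⟦summands⟧≤2 0ℙ 0ℙ = z≤n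
⟦sum⟧+⟦summands⟧≤2 0ℙ 1ℙ = s≤s (s≤s z≤n)
⟦sum⟧+⟦summands⟧≤2 1ℙ 0ℙ = s≤s (s≤s z≤n)
⟦sum⟧+⟦summands⟧≤2 1ℙ 1ℙ = s≤s (s≤s z≤n)

ℙ-solve : ∀ {x y} z → x ≡ y ℙ.+ z → y ≡ x ℙ.+ z
ℙ-solve {x} {y} z x≡y+z = sym (begin
  x ℙ.+ z         ≡⟨ cong (ℙ._+ z) x≡y+z ⟩
  y ℙ.+ z ℙ.+ z   ≡⟨ ℙP.+-assoc y z z ⟩
  y ℙ.+ (z ℙ.+ z) ≡⟨ cong (y ℙ.+_) (ℙP.p+p≡0ℙ z) ⟩
  y ℙ.+ 0ℙ        ≡⟨ ℙP.+-identityʳ y ⟩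
  y               ∎)
  where open ≡-Reasoning

-- Density comparison: if g(s+n) = h(s+n) + g(n) and both are T-periodic, then over a period
-- count(h) + 2 count(g) ≤ 2T, since h(s+m) = g(s+m) + g(m) forbids h(s+m), g(s+m), g(m) all odd.
accumulation-count : ∀ (g h : ℕ → Parity) s T → (∀ n → g (s + n) ≡ h (s + n) ℙ.+ g n) →
                     Periodic h T → Periodic g T → count T h + count T g + count T g ≤ 2 * T
accumulation-count g h s T step per-h per-g = begin
  count T h + count T g + count T g
    ≡⟨ cong₂ (λ x y → x + y + count T g) (count-window per-h s) (count-window per-g s) ⟨
  count T (λ m → h (s + m)) + count T (λ m → g (s + m)) + count T g
    ≤⟨ count-three-≤ T (λ m → h (s + m)) (λ m → g (s + m)) g pointwise ⟩
  2 * T ∎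
  where
  open ≤-Reasoning
  pointwise : ∀ m → ⟦ h (s + m) ⟧ + ⟦ g (s + m) ⟧ + ⟦ g m ⟧ ≤ 2
  pointwise m = subst (λ x → ⟦ x ⟧ + ⟦ g (s + m) ⟧ + ⟦ g m ⟧ ≤ 2)
                      (sym (ℙ-solve (g m) (step m))) (⟦sum⟧+⟦summands⟧≤2 (g (s + m)) (g m))

one-of-two-small : ∀ a b T → a + b + b ≤ 2 * T → 3 * a ≤ 2 * T ⊎ 3 * b ≤ 2 * T
one-of-two-small a b T a+2b≤2T with 3 * a ≤? 2 * T | 3 * b ≤? 2 * T
... | yes 3a≤2T | _         = inj₁ 3a≤2T
... | no  _     | yes 3b≤2T = inj₂ 3b≤2T
... | no  3a≰2T | no  3b≰2T = contradiction (≤-trans (s≤s (m≤n+m (3 * (2 * T)) 2)) tooLarge) (n≮n _)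
  where
  open ≤-Reasoning
  threeTimes : ∀ x → suc x + suc x + suc x ≡ 3 + 3 * x
  threeTimes = solve-∀
  distrib : ∀ a b → 3 * a + 3 * b + 3 * b ≡ 3 * (a + b + b)
  distrib = solve-∀
  tooLarge : 3 + 3 * (2 * T) ≤ 3 * (2 * T)
  tooLarge = begin
    3 + 3 * (2 * T)                         ≡⟨ threeTimes (2 * T) ⟨
    suc (2 * T) + suc (2 * T) + suc (2 * T) ≤⟨ +-mono-≤ (+-mono-≤ (≰⇒> 3a≰2T) (≰⇒> 3b≰2T)) (≰⇒> 3b≰2T) ⟩
    3 * a + 3 * b + 3 * b                   ≡⟨ distrib a b ⟩
    3 * (a + b + b)                         ≤⟨ *-monoʳ-≤ 3 a+2b≤2T ⟩
    3 * (2 * T)                             ∎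

∣⊖∣≡∣-∣ : ∀ m n → ℤ.∣ m ⊖ n ∣ ≡ ∣ m - n ∣
∣⊖∣≡∣-∣ m n with ≤-total m n
... | inj₁ m≤n = trans (ℤP.∣⊖∣-≤ m≤n) (sym (m≤n⇒∣m-n∣≡n∸m m≤n))
... | inj₂ n≤m = trans (ℤP.∣m⊖n∣≡∣n⊖m∣ m n) (trans (ℤP.∣⊖∣-≤ n≤m) (sym (m≤n⇒∣n-m∣≡n∸m n≤m)))

∣a/M-c/Q∣ : ∀ a M c Q → toℚᵘ (ℚ.∣ (ℤ.+ a) ℚ./ suc M ℚ.- (ℤ.+ c) ℚ./ suc Q ∣)
                        ℚᵘ.≃ ℚᵘ.∣ mkℚᵘ (ℤ.+ a) M ℚᵘ.- mkℚᵘ (ℤ.+ c) Q ∣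
∣a/M-c/Q∣ a M c Q =
  ℚᵘP.≃-trans (ℚP.toℚᵘ-homo-∣-∣ (x ℚ.- y))
    (ℚᵘP.∣-∣-cong (ℚᵘP.≃-trans (ℚP.toℚᵘ-homo-+ x (ℚ.- y))
      (ℚᵘP.+-cong (ℚP.toℚᵘ-fromℚᵘ (mkℚᵘ (ℤ.+ a) M))
                  (ℚᵘP.≃-trans (ℚP.toℚᵘ-homo‿- y) (ℚᵘP.-‿cong (ℚP.toℚᵘ-fromℚᵘ (mkℚᵘ (ℤ.+ c) Q)))))))
  where
  x = (ℤ.+ a) ℚ./ suc M
  y = (ℤ.+ c) ℚ./ suc Q

-- The unnormalised distance |a/(M+1) − c/(Q+1)| has numerator |a(Q+1) − c(M+1)| and denominator
-- (M+1)(Q+1), so comparing it with (n+1)/(d+1) is a cross-multiplied inequality of naturals.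
distance-< : ∀ a M c Q n d → ∣ a * suc Q - c * suc M ∣ * suc d < suc n * (suc M * suc Q) →
             ℚᵘ.∣ mkℚᵘ (ℤ.+ a) M ℚᵘ.- mkℚᵘ (ℤ.+ c) Q ∣ ℚᵘ.< mkℚᵘ +[1+ n ] d
distance-< a M c Q n d cross = *<* (subst₂ ℤ._<_ (ℤP.pos-* ℤ.∣ numerator ∣ (suc d)) (ℤP.pos-* (suc n) (suc M * suc Q))
                                              (ℤ.+<+ (subst (λ e → e * suc d < _) (sym ∣numerator∣) cross)))
  where
  numerator : ℤ
  numerator = (ℤ.+ a) ℤ.* (ℤ.+ suc Q) ℤ.+ (ℤ.- (ℤ.+ c)) ℤ.* (ℤ.+ suc M)
  ∣numerator∣ : ℤ.∣ numerator ∣ ≡ ∣ a * suc Q - c * suc M ∣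
  ∣numerator∣ = begin
    ℤ.∣ numerator ∣
      ≡⟨ cong ℤ.∣_∣ (cong₂ ℤ._+_ (sym (ℤP.pos-* a (suc Q))) (sym (ℤP.neg-distribˡ-* (ℤ.+ c) (ℤ.+ suc M)))) ⟩
    ℤ.∣ ℤ.+ (a * suc Q) ℤ.+ ℤ.- ((ℤ.+ c) ℤ.* (ℤ.+ suc M)) ∣
      ≡⟨ cong (λ e → ℤ.∣ ℤ.+ (a * suc Q) ℤ.+ ℤ.- e ∣) (sym (ℤP.pos-* c (suc M))) ⟩
    ℤ.∣ ℤ.+ (a * suc Q) ℤ.+ ℤ.- (ℤ.+ (c * suc M)) ∣
      ≡⟨ cong ℤ.∣_∣ (ℤP.m-n≡m⊖n (a * suc Q) (c * suc M)) ⟩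
    ℤ.∣ (a * suc Q) ⊖ (c * suc M) ∣
      ≡⟨ ∣⊖∣≡∣-∣ (a * suc Q) (c * suc M) ⟩
    ∣ a * suc Q - c * suc M ∣ ∎
    where open ≡-Reasoning

-- Bounded cross-multiplied error implies convergence: if |a_M · Q − c · (M+1)| ≤ K for all M,
-- then a_M/(M+1) → c/Q, with threshold M₀ = K(d+1) for the tolerance (n+1)/(d+1).
ratio-converges : ∀ (a : ℕ → ℕ) c Q K → (∀ M → ∣ a M * suc Q - c * suc M ∣ ≤ K) →
                  ConvergesTo (λ M → (ℤ.+ a M) ℚ./ suc M) ((ℤ.+ c) ℚ./ suc Q)
ratio-converges a c Q K bounded (mkℚ +[1+ n ] d _) _ = K * suc d , λ M M≥M₀ →
  ℚP.toℚᵘ-cancel-< (ℚᵘP.<-respˡ-≃ (ℚᵘP.≃-sym (∣a/M-c/Q∣ (a M) M c Q))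
                                 (distance-< (a M) M c Q n d (cross M M≥M₀)))
  where
  cross : ∀ M → M ≥ K * suc d → ∣ a M * suc Q - c * suc M ∣ * suc d < suc n * (suc M * suc Q)
  cross M M≥M₀ = begin-strict
    ∣ a M * suc Q - c * suc M ∣ * suc d ≤⟨ *-monoˡ-≤ (suc d) (bounded M) ⟩
    K * suc d                           ≤⟨ M≥M₀ ⟩
    M                                   <⟨ n<1+n M ⟩
    suc M                               ≤⟨ m≤m*n (suc M) (suc Q) ⟩
    suc M * suc Q                       ≤⟨ m≤n*m (suc M * suc Q) (suc n) ⟩
    suc n * (suc M * suc Q)             ∎
    where open ≤-Reasoning
ratio-converges a c Q K bounded (mkℚ (ℤ.+ 0) d _) ε>0 with ℚP.toℚᵘ-mono-< ε>0
... | *<* (ℤ.+<+ ())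
ratio-converges a c Q K bounded (mkℚ -[1+ n ] d _) ε>0 with ℚP.toℚᵘ-mono-< ε>0
... | *<* ()

ConvergesTo-cong : ∀ {r r' : ℕ → ℚ} {L} → (∀ M → r M ≡ r' M) → ConvergesTo r L → ConvergesTo r' L
ConvergesTo-cong {L = L} r≗r' conv ε ε>0 with conv ε ε>0
... | M₀ , close = M₀ , λ M M≥M₀ → subst (λ x → ℚ.∣ x ℚ.- L ∣ ℚ.< ε) (r≗r' M) (close M M≥M₀)

-- A periodic parity sequence has asymptotic density count(Q)/Q; the ratio is taken in the
-- form used by oddRatio (N+1 terms over N).
periodic-density : ∀ {f T} → Periodic f (suc T) →
                   ConvergesTo (λ M → (ℤ.+ count (suc (suc M)) f) ℚ./ suc M) ((ℤ.+ count (suc T) f) ℚ./ suc T)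
periodic-density {f} {T} per = ratio-converges (λ M → count (suc (suc M)) f) c T (Q * Q + Q) error
  where
  Q = suc T
  c = count Q f
  -- replacing the denominator M+2 by M+1 changes the cross-multiplied error by c ≤ Q
  error : ∀ M → ∣ count (suc (suc M)) f * Q - c * suc M ∣ ≤ Q * Q + Q
  error M = begin
    ∣ count (suc N) f * Q - c * N ∣
      ≤⟨ ∣-∣-triangle (count (suc N) f * Q) (c * suc N) (c * N) ⟩
    ∣ count (suc N) f * Q - c * suc N ∣ + ∣ c * suc N - c * N ∣
      ≤⟨ +-mono-≤ (count-periodic-error per (suc N)) (≤-reflexive one-more-term) ⟩
    Q * Q + c
      ≤⟨ +-monoʳ-≤ (Q * Q) (count-≤ Q f) ⟩
    Q * Q + Q ∎
    where
    open ≤-Reasoning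
    N = suc M
    one-more-term : ∣ c * suc N - c * N ∣ ≡ c
    one-more-term = trans (cong ∣_- c * N ∣ (trans (*-suc c N) (+-comm c (c * N))))
                          (trans (∣-∣-comm (c * N + c) (c * N)) (∣m-m+n∣≡n (c * N) c))

fraction-≤-2/3 : ∀ c T → 3 * c ≤ 2 * suc T → (ℤ.+ c) ℚ./ suc T ℚ.≤ (ℤ.+ 2) ℚ./ 3
fraction-≤-2/3 c T 3c≤2Q =
  ℚP.toℚᵘ-cancel-≤ (ℚᵘP.≤-respʳ-≃ (ℚᵘP.≃-sym (ℚP.toℚᵘ-fromℚᵘ (mkℚᵘ (ℤ.+ 2) 2)))
                     (ℚᵘP.≤-respˡ-≃ (ℚᵘP.≃-sym (ℚP.toℚᵘ-fromℚᵘ (mkℚᵘ (ℤ.+ c) T))) (*≤* cross)))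
  where
  cross : ℤ.+ c ℤ.* ℤ.+ 3 ℤ.≤ ℤ.+ 2 ℤ.* ℤ.+ suc T
  cross = subst₂ ℤ._≤_ (ℤP.pos-* c 3) (ℤP.pos-* 2 (suc T)) (ℤ.+≤+ (subst (_≤ 2 * suc T) (*-comm 3 c) 3c≤2Q))

odd-density-≤-2/3 : ∀ k T → Periodic (A k) (suc T) → 3 * count (suc T) (A k) ≤ 2 * suc T →
                    ∃[ L ] (ConvergesTo (oddRatio k) L × L ℚ.≤ (ℤ.+ 2) ℚ./ 3)
odd-density-≤-2/3 k T per small =
  _ , ConvergesTo-cong (λ M → cong (λ x → (ℤ.+ x) ℚ./ suc M) (sym (oddCount≡count k (suc M)))) (periodic-density per)
    , fraction-≤-2/3 (count (suc T) (A k)) T small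

theorem1p2 : ∀ (m : ℕ) → ∃[ k ] (k > m × ∃[ L ] (ConvergesTo (oddRatio k) L × L ℚ.≤ (ℤ.+ 2) ℚ./ 3))
theorem1p2 m with A-common-period m
... | T , per₁ , per₂
  with one-of-two-small (count (suc T) (A (suc m))) (count (suc T) (A (suc (suc m)))) (suc T)
         (accumulation-count (A (suc (suc m))) (A (suc m)) (suc (suc m)) (suc T) (A-recurrence (suc m)) per₁ per₂)
... | inj₁ small = suc m       , ≤-refl        , odd-density-≤-2/3 (suc m) T per₁ small
... | inj₂ small = suc (suc m) , n≤1+n (suc m) , odd-density-≤-2/3 (suc (suc m)) T per₂ small
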